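{- Let $n\ge 0$ and $j\ge 0$ be integers. The number of partitions $\pi$ into distinct parts with $\mathcal{E}(\pi)=n$ and $\gamma(\pi)=j$ equals the number of partitions of $n$ into parts $\le j$.
   Context: A partition $\pi=(\lambda_1,\lambda_2,\dots)$ is a finite non-increasing sequence of positive integers; the empty sequence is the unique partition of $0$. $\mathcal{E}(\pi)=\lambda_2+\lambda_4+\lambda_6+\cdots$ is the sum of the even-indexed parts, and $\gamma(\pi)=\lambda_1-\lambda_2+\lambda_3-\lambda_4+\cdots$ is the alternating sum of parts. -}

module Defs where

open import Data.Nat using (ℕ; zero; suc; _+_; _≤_; _<_; _≥_; _>_)
open import Data.Integer as ℤ using (ℤ; +_)
open import Data.List using (List; []; _∷_)
open import Data.List.Relation.Unary.All using (All)
open import Data.List.Relation.Unary.Linked using (Linked)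
open import Data.Product using (_×_)

IsPartition : List ℕ → Set
IsPartition l = Linked _≥_ l × All (0 <_) l

IsDistinctPartition : List ℕ → Set
IsDistinctPartition l = Linked _>_ l × All (0 <_) l

-- Sum of the even-indexed parts λ₂ + λ₄ + ⋯  (1-based indexing).
evenSum : List ℕ → ℕ
evenSum [] = 0
evenSum (a ∷ []) = 0
evenSum (a ∷ b ∷ l) = b + evenSum l

altSum : List ℕ → ℤ
altSum [] = + 0
altSum (a ∷ l) = + a ℤ.- altSum l

{-# OPTIONS --safe #-}
module Submission where

-- Write γ for the alternating sum and E for the even-indexed sum. Peeling off the
-- largest part, E (a ∷ t) = γ t + E t with γ t < a. So, building from the smallest
-- part upwards, φ (a ∷ t) := conjugate of (γ t ∷ φ t) is a partition of E (a ∷ t);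
-- its parts are at most 1 + length (φ t) ≤ a − γ t = γ (a ∷ t). Conversely φ (a ∷ t)
-- has exactly γ t parts, so from ρ = φ π and j = γ π one reads off
-- a = j + length ρ, strips the first column of ρ, removes the top row γ t, and
-- recurses on φ t.

open import Defs
open import Axiom.UniquenessOfIdentityProofs using (module Decidable⇒UIP)
open import Data.Empty using (⊥-elim)
open import Data.Integer using (+_)
import Data.Integer as ℤ
import Data.Integer.Properties as ℤP
open import Data.List using (List; []; _∷_; length)
open import Data.List.Relation.Unary.All as All using (All; []; _∷_)
open import Data.List.Relation.Unary.Linked as Linked using (Linked; []; [-]; _∷_)
open import Data.Nat using (ℕ; zero; suc; _+_; _∸_; _≤_; _<_; _>_; _≥_; z≤n; s≤s)
open import Data.Nat.ListAction using (sum)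
open import Data.Nat.Properties
open import Algebra.Properties.CommutativeSemigroup +-commutativeSemigroup using (x∙yz≈y∙xz)
open import Data.Product using (Σ; _×_; _,_; ∃; proj₁; proj₂)
open import Data.Product.Properties using (Σ-≡,≡→≡)
open import Function.Bundles using (_↔_; mk↔ₛ′)
open import Relation.Binary.PropositionalEquality
  using (_≡_; refl; sym; trans; cong; cong₂; subst; module ≡-Reasoning)
open import Relation.Nullary.Irrelevant using (Irrelevant)

data Distinct< : ℕ → List ℕ → Set where
  [] : ∀ {b} → Distinct< b []
  cons : ∀ {b a t} → 0 < a → a < b → Distinct< a t → Distinct< b (a ∷ t)

data Partition≤ : ℕ → List ℕ → Set where
  [] : ∀ {b} → Partition≤ b []
  cons : ∀ {b a ρ} → 0 < a → a ≤ b → Partition≤ a ρ → Partition≤ b (a ∷ ρ)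

Distinct<-weaken : ∀ {b b′ π} → b ≤ b′ → Distinct< b π → Distinct< b′ π
Distinct<-weaken _ [] = []
Distinct<-weaken b≤b′ (cons p q s) = cons p (≤-trans q b≤b′) s

Partition≤-weaken : ∀ {b b′ ρ} → b ≤ b′ → Partition≤ b ρ → Partition≤ b′ ρ
Partition≤-weaken _ [] = []
Partition≤-weaken b≤b′ (cons p q s) = cons p (≤-trans q b≤b′) s

Partition≤0⇒≡[] : ∀ {ρ} → Partition≤ 0 ρ → ρ ≡ []
Partition≤0⇒≡[] [] = refl
Partition≤0⇒≡[] (cons p q _) = ⊥-elim (n≮0 (<-≤-trans p q))

-- On distinct partitions every partial alternating sum is non-negative, so it can be
-- computed with truncated subtraction.
altSumℕ : List ℕ → ℕ
altSumℕ [] = 0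
altSumℕ (a ∷ t) = a ∸ altSumℕ t

altSumℕ<bound : ∀ {b t} → 0 < b → Distinct< b t → altSumℕ t < b
altSumℕ<bound 0<b [] = 0<b
altSumℕ<bound _ (cons {a = a} {t = t} _ a<b _) = ≤-<-trans (m∸n≤m a (altSumℕ t)) a<b

altSumℕ-pos : ∀ {b a t} → Distinct< b (a ∷ t) → 0 < altSumℕ (a ∷ t)
altSumℕ-pos (cons 0<a _ s) = m<n⇒0<n∸m (altSumℕ<bound 0<a s)

altSum≡altSumℕ : ∀ {b π} → Distinct< b π → altSum π ≡ + altSumℕ π
altSum≡altSumℕ [] = refl
altSum≡altSumℕ (cons {a = a} {t = t} 0<a _ s) = begin
  + a ℤ.- altSum t ≡⟨ cong (λ x → + a ℤ.- x) (altSum≡altSumℕ s) ⟩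
  + a ℤ.- + altSumℕ t ≡⟨ ℤP.[+m]-[+n]≡m⊖n a (altSumℕ t) ⟩
  a ℤ.⊖ altSumℕ t ≡⟨ ℤP.⊖-≥ (<⇒≤ (altSumℕ<bound 0<a s)) ⟩
  + (a ∸ altSumℕ t) ∎
  where open ≡-Reasoning

altSumℕ≡ : ∀ {b j π} → Distinct< b π → altSum π ≡ + j → altSumℕ π ≡ j
altSumℕ≡ s γ≡j = ℤP.+-injective (trans (sym (altSum≡altSumℕ s)) γ≡j)

evenSum-∷ : ∀ {b a t} → Distinct< b t → evenSum (a ∷ t) ≡ altSumℕ t + evenSum t
evenSum-∷ [] = refl
evenSum-∷ (cons {a = c} {t = t} 0<c _ s) = begin
  c + evenSum t ≡⟨ cong (_+ evenSum t) (sym (m∸n+n≡m (<⇒≤ (altSumℕ<bound 0<c s)))) ⟩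
  (c ∸ altSumℕ t + altSumℕ t) + evenSum t ≡⟨ +-assoc (c ∸ altSumℕ t) (altSumℕ t) (evenSum t) ⟩
  c ∸ altSumℕ t + (altSumℕ t + evenSum t) ≡⟨ cong (_+_ (c ∸ altSumℕ t)) (sym (evenSum-∷ {a = c} s)) ⟩
  c ∸ altSumℕ t + evenSum (c ∷ t) ∎
  where open ≡-Reasoning

-- For length ρ ≤ w, addColumn w ρ is the conjugate of w ∷ (conjugate of ρ), and
-- dropColumn undoes it.
addColumn : ℕ → List ℕ → List ℕ
addColumn zero ρ = ρ
addColumn (suc w) [] = 1 ∷ addColumn w []
addColumn (suc w) (a ∷ ρ) = suc a ∷ addColumn w ρ

dropColumn : List ℕ → List ℕ
dropColumn [] = []
dropColumn (suc (suc a) ∷ ρ) = suc a ∷ dropColumn ρ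
dropColumn (_ ∷ ρ) = dropColumn ρ

length-addColumn : ∀ {w ρ} → length ρ ≤ w → length (addColumn w ρ) ≡ w
length-addColumn {zero} {[]} _ = refl
length-addColumn {suc w} {[]} _ = cong suc (length-addColumn {w} {[]} z≤n)
length-addColumn {suc w} {_ ∷ _} (s≤s ρ≤w) = cong suc (length-addColumn ρ≤w)

sum-addColumn : ∀ {w ρ} → length ρ ≤ w → sum (addColumn w ρ) ≡ w + sum ρ
sum-addColumn {zero} {[]} _ = refl
sum-addColumn {suc w} {[]} _ = cong suc (sum-addColumn {w} {[]} z≤n)
sum-addColumn {suc w} {a ∷ ρ} (s≤s ρ≤w) = cong suc (begin
  a + sum (addColumn w ρ) ≡⟨ cong (_+_ a) (sum-addColumn ρ≤w) ⟩
  a + (w + sum ρ)         ≡⟨ x∙yz≈y∙xz a w (sum ρ) ⟩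
  w + (a + sum ρ)         ∎)
  where open ≡-Reasoning

addColumn-Partition≤ : ∀ {c w ρ} → Partition≤ c ρ → length ρ ≤ w → Partition≤ (suc c) (addColumn w ρ)
addColumn-Partition≤ {w = zero} [] _ = []
addColumn-Partition≤ {w = suc w} [] _ = Partition≤-weaken (s≤s z≤n) (cons (s≤s z≤n) ≤-refl (ones w))
  where
  ones : ∀ w → Partition≤ 1 (addColumn w [])
  ones zero = []
  ones (suc w) = cons (s≤s z≤n) ≤-refl (ones w)
addColumn-Partition≤ {w = suc w} (cons _ a≤c s) (s≤s ρ≤w) = cons (s≤s z≤n) (s≤s a≤c) (addColumn-Partition≤ s ρ≤w)

dropColumn-Partition≤ : ∀ {c ρ} → Partition≤ (suc c) ρ → Partition≤ c (dropColumn ρ)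
dropColumn-Partition≤ [] = []
dropColumn-Partition≤ (cons {a = suc zero} _ _ s) = Partition≤-weaken z≤n (dropColumn-Partition≤ s)
dropColumn-Partition≤ (cons {a = suc (suc a)} _ (s≤s a<c) s) = cons (s≤s z≤n) a<c (dropColumn-Partition≤ s)

length-dropColumn : ∀ ρ → length (dropColumn ρ) ≤ length ρ
length-dropColumn [] = z≤n
length-dropColumn (zero ∷ ρ) = m≤n⇒m≤1+n (length-dropColumn ρ)
length-dropColumn (suc zero ∷ ρ) = m≤n⇒m≤1+n (length-dropColumn ρ)
length-dropColumn (suc (suc _) ∷ ρ) = s≤s (length-dropColumn ρ)

dropColumn-addColumn : ∀ {c w ρ} → Partition≤ c ρ → length ρ ≤ w → dropColumn (addColumn w ρ) ≡ ρ
dropColumn-addColumn {w = w} [] _ = dropColumn-ones w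
  where
  dropColumn-ones : ∀ w → dropColumn (addColumn w []) ≡ []
  dropColumn-ones zero = refl
  dropColumn-ones (suc w) = dropColumn-ones w
dropColumn-addColumn {w = suc w} (cons {a = suc a} _ _ s) (s≤s ρ≤w) = cong (suc a ∷_) (dropColumn-addColumn s ρ≤w)

addColumn-dropColumn : ∀ {c ρ} → Partition≤ c ρ → addColumn (length ρ) (dropColumn ρ) ≡ ρ
addColumn-dropColumn [] = refl
addColumn-dropColumn (cons {a = suc (suc a)} _ _ s) = cong (suc (suc a) ∷_) (addColumn-dropColumn s)
addColumn-dropColumn (cons {a = suc zero} {ρ = ρ} _ _ s) = begin
  addColumn (suc (length ρ)) (dropColumn ρ) ≡⟨ cong (addColumn (suc (length ρ))) drop≡[] ⟩
  1 ∷ addColumn (length ρ) []               ≡⟨ cong (λ σ → 1 ∷ addColumn (length ρ) σ) (sym drop≡[]) ⟩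
  1 ∷ addColumn (length ρ) (dropColumn ρ)   ≡⟨ cong (1 ∷_) (addColumn-dropColumn s) ⟩
  1 ∷ ρ                                     ∎
  where
  open ≡-Reasoning
  drop≡[] : dropColumn ρ ≡ []
  drop≡[] = Partition≤0⇒≡[] (dropColumn-Partition≤ s)

suc[m∸suc[n]]≡m∸n : ∀ {m n} → n < m → suc (m ∸ suc n) ≡ m ∸ n
suc[m∸suc[n]]≡m∸n n<m = sym (+-∸-assoc 1 n<m)

m≤n<o⇒m≤o∸suc[n∸m] : ∀ {m n o} → m ≤ n → n < o → m ≤ o ∸ suc (n ∸ m)
m≤n<o⇒m≤o∸suc[n∸m] {m} {n} {suc o} m≤n (s≤s n≤o) = begin
  m             ≡⟨ sym (m∸[m∸n]≡n m≤n) ⟩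
  n ∸ (n ∸ m)   ≤⟨ ∸-monoˡ-≤ (n ∸ m) n≤o ⟩
  o ∸ (n ∸ m)   ∎
  where open ≤-Reasoning

-- φᵀ π is the conjugate of φ π; defining both avoids a conjugation function.
mutual
  φ : List ℕ → List ℕ
  φ [] = []
  φ (_ ∷ t) = addColumn (altSumℕ t) (φᵀ t)

  φᵀ : List ℕ → List ℕ
  φᵀ [] = []
  φᵀ (_ ∷ []) = []
  φᵀ (_ ∷ t@(_ ∷ _)) = altSumℕ t ∷ φ t

φᵀ-∷ : ∀ {a t} → 0 < altSumℕ t → φᵀ (a ∷ t) ≡ altSumℕ t ∷ φ t
φᵀ-∷ {t = _ ∷ _} _ = refl

mutual
  φ-shape : ∀ {b π} → Distinct< b π →
    Partition≤ (altSumℕ π) (φ π) × length (φ π) ≤ b ∸ suc (altSumℕ π)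
  φ-shape [] = [] , z≤n
  φ-shape {b} (cons {a = a} {t = t} 0<a a<b s) with φᵀ-shape s
  ... | parts , len =
    subst (λ c → Partition≤ c (φ (a ∷ t))) (suc[m∸suc[n]]≡m∸n γ<a) (addColumn-Partition≤ parts len)
    , subst (_≤ b ∸ suc (a ∸ altSumℕ t)) (sym (length-addColumn len)) (m≤n<o⇒m≤o∸suc[n∸m] (<⇒≤ γ<a) a<b)
    where
    γ<a : altSumℕ t < a
    γ<a = altSumℕ<bound 0<a s

  φᵀ-shape : ∀ {b π} → Distinct< b π →
    Partition≤ (b ∸ suc (altSumℕ π)) (φᵀ π) × length (φᵀ π) ≤ altSumℕ π
  φᵀ-shape [] = [] , z≤n
  φᵀ-shape (cons _ _ []) = [] , z≤n
  φᵀ-shape (cons {a = a} 0<a a<b s@(cons {a = c} {t = t} _ _ _)) with φ-shape s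
  ... | parts , len =
    cons (altSumℕ-pos s) (m≤n<o⇒m≤o∸suc[n∸m] (<⇒≤ γ<a) a<b) parts
    , ≤-trans (s≤s len) (≤-reflexive (suc[m∸suc[n]]≡m∸n γ<a))
    where
    γ<a : altSumℕ (c ∷ t) < a
    γ<a = altSumℕ<bound 0<a s

mutual
  sum-φ : ∀ {b π} → Distinct< b π → sum (φ π) ≡ evenSum π
  sum-φ [] = refl
  sum-φ (cons {a = a} {t = t} _ _ s) = begin
    sum (addColumn (altSumℕ t) (φᵀ t)) ≡⟨ sum-addColumn (φᵀ-shape s .proj₂) ⟩
    altSumℕ t + sum (φᵀ t)             ≡⟨ cong (_+_ (altSumℕ t)) (sum-φᵀ s) ⟩
    altSumℕ t + evenSum t              ≡⟨ sym (evenSum-∷ s) ⟩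
    evenSum (a ∷ t)                    ∎
    where open ≡-Reasoning

  sum-φᵀ : ∀ {b π} → Distinct< b π → sum (φᵀ π) ≡ evenSum π
  sum-φᵀ [] = refl
  sum-φᵀ (cons _ _ []) = refl
  sum-φᵀ (cons {a = a} _ _ s@(cons {a = c} {t = t} _ _ _)) =
    trans (cong (_+_ (altSumℕ (c ∷ t))) (sum-φ s)) (sym (evenSum-∷ {a = a} s))

single⁺ : ℕ → List ℕ
single⁺ zero = []
single⁺ (suc j) = suc j ∷ []

single⁺-Distinct< : ∀ {b j} → j < b → Distinct< b (single⁺ j)
single⁺-Distinct< {j = zero} _ = []
single⁺-Distinct< {j = suc j} j<b = cons (s≤s z≤n) j<b []

altSumℕ-single⁺ : ∀ j → altSumℕ (single⁺ j) ≡ j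
altSumℕ-single⁺ zero = refl
altSumℕ-single⁺ (suc j) = refl

φ-single⁺ : ∀ j → φ (single⁺ j) ≡ []
φ-single⁺ zero = refl
φ-single⁺ (suc j) = refl

φᵀ-single⁺ : ∀ j → φᵀ (single⁺ j) ≡ []
φᵀ-single⁺ zero = refl
φᵀ-single⁺ (suc j) = refl

-- The first argument is fuel: it bounds the parts of ρ, and dropColumn lowers that bound by one.
mutual
  ψ : ℕ → ℕ → List ℕ → List ℕ
  ψ _ j [] = single⁺ j
  ψ zero _ (_ ∷ _) = []
  ψ (suc b) j ρ@(_ ∷ _) = j + length ρ ∷ ψᵀ b (length ρ) (dropColumn ρ)

  ψᵀ : ℕ → ℕ → List ℕ → List ℕ
  ψᵀ _ j [] = single⁺ j
  ψᵀ b j (v ∷ σ) = j + v ∷ ψ b v σ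

mutual
  ψ-spec : ∀ {b j ρ} → Partition≤ b ρ → Partition≤ j ρ →
    Distinct< (suc (j + length ρ)) (ψ b j ρ) × altSumℕ (ψ b j ρ) ≡ j × φ (ψ b j ρ) ≡ ρ
  ψ-spec {j = j} [] _ = single⁺-Distinct< (s≤s (m≤m+n j 0)) , altSumℕ-single⁺ j , φ-single⁺ j
  ψ-spec {zero} (cons 0<a a≤0 _) _ = ⊥-elim (n≮0 (<-≤-trans 0<a a≤0))
  ψ-spec {_} {zero} _ (cons 0<a a≤0 _) = ⊥-elim (n≮0 (<-≤-trans 0<a a≤0))
  ψ-spec {suc b} {suc j} {ρ} fuel@(cons _ _ _) parts
    with ψᵀ-spec (dropColumn-Partition≤ fuel) (dropColumn-Partition≤ parts) (length-dropColumn ρ)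
  ... | distinct , alt , φᵀ≡ =
    cons (s≤s z≤n) ≤-refl (Distinct<-weaken (≤-reflexive (cong suc (+-comm (length ρ) j))) distinct)
    , trans (cong (suc j + length ρ ∸_) alt) (m+n∸n≡m (suc j) (length ρ))
    , trans (cong₂ addColumn alt φᵀ≡) (addColumn-dropColumn fuel)

  ψᵀ-spec : ∀ {b c j σ} → Partition≤ b σ → Partition≤ c σ → length σ ≤ j →
    Distinct< (suc (j + c)) (ψᵀ b j σ) × altSumℕ (ψᵀ b j σ) ≡ j × φᵀ (ψᵀ b j σ) ≡ σ
  ψᵀ-spec {c = c} {j} [] _ _ = single⁺-Distinct< (s≤s (m≤m+n j c)) , altSumℕ-single⁺ j , φᵀ-single⁺ j
  ψᵀ-spec {b} {c} {j} {v ∷ σ} (cons _ v≤b fuel) (cons 0<v v≤c parts) σ<j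
    with ψ-spec (Partition≤-weaken v≤b fuel) parts
  ... | distinct , alt , φ≡ =
    cons (≤-trans 0<v (m≤n+m v j)) (s≤s (+-monoʳ-≤ j v≤c)) (Distinct<-weaken head-bound distinct)
    , trans (cong (j + v ∸_) alt) (m+n∸n≡m j v)
    , trans (φᵀ-∷ (subst (0 <_) (sym alt) 0<v)) (cong₂ _∷_ alt φ≡)
    where
    head-bound : suc (v + length σ) ≤ j + v
    head-bound = begin
      suc (v + length σ) ≡⟨ sym (+-suc v (length σ)) ⟩
      v + suc (length σ) ≤⟨ +-monoʳ-≤ v σ<j ⟩
      v + j              ≡⟨ +-comm v j ⟩
      j + v              ∎
      where open ≤-Reasoning

ψ-suc : ∀ {b j ρ} → 0 < length ρ → ψ (suc b) j ρ ≡ j + length ρ ∷ ψᵀ b (length ρ) (dropColumn ρ)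
ψ-suc {ρ = _ ∷ _} _ = refl

ψ-addColumn : ∀ {b c j w σ} → Partition≤ c σ → length σ ≤ w → 0 < w →
  ψ (suc b) j (addColumn w σ) ≡ j + w ∷ ψᵀ b w σ
ψ-addColumn {b} {j = j} {w} {σ} parts σ≤w 0<w = begin
  ψ (suc b) j (addColumn w σ)
    ≡⟨ ψ-suc {ρ = addColumn w σ} (subst (0 <_) (sym length≡w) 0<w) ⟩
  j + length (addColumn w σ) ∷ ψᵀ b (length (addColumn w σ)) (dropColumn (addColumn w σ))
    ≡⟨ cong₂ (λ l τ → j + l ∷ ψᵀ b l τ) length≡w (dropColumn-addColumn parts σ≤w) ⟩
  j + w ∷ ψᵀ b w σ
    ∎
  where
  open ≡-Reasoning
  length≡w : length (addColumn w σ) ≡ w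
  length≡w = length-addColumn σ≤w

mutual
  ψ-φ : ∀ {b c π} → Distinct< c π → Partition≤ b (φ π) → ψ b (altSumℕ π) (φ π) ≡ π
  ψ-φ [] _ = refl
  ψ-φ (cons {a = suc _} _ _ []) _ = refl
  ψ-φ {zero} (cons {t = t} _ _ s@(cons _ _ _)) fuel =
    ⊥-elim (<⇒≢ (altSumℕ-pos s) (sym γ≡0))
    where
    γ≡0 : altSumℕ t ≡ 0
    γ≡0 = trans (sym (length-addColumn (φᵀ-shape s .proj₂))) (cong length (Partition≤0⇒≡[] fuel))
  ψ-φ {suc b} (cons {a = a} {t = t} 0<a _ s@(cons _ _ _)) fuel = begin
    ψ (suc b) (a ∸ altSumℕ t) (addColumn (altSumℕ t) (φᵀ t)) ≡⟨ ψ-addColumn parts len (altSumℕ-pos s) ⟩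
    a ∸ altSumℕ t + altSumℕ t ∷ ψᵀ b (altSumℕ t) (φᵀ t)    ≡⟨ cong₂ _∷_ (m∸n+n≡m (<⇒≤ (altSumℕ<bound 0<a s))) (ψᵀ-φᵀ s fuel′) ⟩
    a ∷ t                                                    ∎
    where
    open ≡-Reasoning
    parts : Partition≤ (a ∸ suc (altSumℕ t)) (φᵀ t)
    parts = φᵀ-shape s .proj₁
    len : length (φᵀ t) ≤ altSumℕ t
    len = φᵀ-shape s .proj₂
    fuel′ : Partition≤ b (φᵀ t)
    fuel′ = subst (Partition≤ b) (dropColumn-addColumn parts len) (dropColumn-Partition≤ fuel)

  ψᵀ-φᵀ : ∀ {b c π} → Distinct< c π → Partition≤ b (φᵀ π) → ψᵀ b (altSumℕ π) (φᵀ π) ≡ π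
  ψᵀ-φᵀ [] _ = refl
  ψᵀ-φᵀ (cons {a = suc _} _ _ []) _ = refl
  ψᵀ-φᵀ (cons 0<a _ s@(cons _ _ _)) (cons _ v≤b fuel) =
    cong₂ _∷_ (m∸n+n≡m (<⇒≤ (altSumℕ<bound 0<a s))) (ψ-φ s (Partition≤-weaken v≤b fuel))

Distinct<⇒IsDistinctPartition : ∀ {b π} → Distinct< b π → IsDistinctPartition π
Distinct<⇒IsDistinctPartition s = Linked.tail (linked s) , positive s
  where
  linked : ∀ {b π} → Distinct< b π → Linked _>_ (b ∷ π)
  linked [] = [-]
  linked (cons _ a<b s) = a<b ∷ linked s
  positive : ∀ {b π} → Distinct< b π → All (0 <_) π
  positive [] = []
  positive (cons 0<a _ s) = 0<a ∷ positive s

IsDistinctPartition⇒Distinct< : ∀ {π} → IsDistinctPartition π → ∃ λ b → Distinct< b π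
IsDistinctPartition⇒Distinct< {[]} _ = 0 , []
IsDistinctPartition⇒Distinct< {a ∷ _} (linked , positive) = suc a , fromLinked (n<1+n a ∷ linked) positive
  where
  fromLinked : ∀ {b π} → Linked _>_ (b ∷ π) → All (0 <_) π → Distinct< b π
  fromLinked [-] [] = []
  fromLinked (a<b ∷ linked) (0<a ∷ positive) = cons 0<a a<b (fromLinked linked positive)

Partition≤⇒IsPartition : ∀ {b ρ} → Partition≤ b ρ → IsPartition ρ × All (_≤ b) ρ
Partition≤⇒IsPartition s = (Linked.tail (linked s) , positive s) , bounded s
  where
  linked : ∀ {b ρ} → Partition≤ b ρ → Linked _≥_ (b ∷ ρ)
  linked [] = [-]
  linked (cons _ a≤b s) = a≤b ∷ linked s
  positive : ∀ {b ρ} → Partition≤ b ρ → All (0 <_) ρ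
  positive [] = []
  positive (cons 0<a _ s) = 0<a ∷ positive s
  bounded : ∀ {b ρ} → Partition≤ b ρ → All (_≤ b) ρ
  bounded [] = []
  bounded (cons _ a≤b s) = a≤b ∷ All.map (λ c≤a → ≤-trans c≤a a≤b) (bounded s)

IsPartition⇒Partition≤ : ∀ {b ρ} → IsPartition ρ → All (_≤ b) ρ → Partition≤ b ρ
IsPartition⇒Partition≤ ([] , []) [] = []
IsPartition⇒Partition≤ (linked , 0<a ∷ positive) (a≤b ∷ _) = cons 0<a a≤b (fromLinked linked positive)
  where
  fromLinked : ∀ {b ρ} → Linked _≥_ (b ∷ ρ) → All (0 <_) ρ → Partition≤ b ρ
  fromLinked [-] [] = []
  fromLinked (a≤b ∷ linked) (0<a ∷ positive) = cons 0<a a≤b (fromLinked linked positive)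

φ⁻¹ : ℕ → List ℕ → List ℕ
φ⁻¹ j = ψ j j

φ-correct : ∀ {j π} → IsDistinctPartition π → altSum π ≡ + j →
  IsPartition (φ π) × sum (φ π) ≡ evenSum π × All (_≤ j) (φ π)
φ-correct {π = π} distinct γ≡j with IsDistinctPartition⇒Distinct< distinct
... | _ , s =
  let partition , bounded = Partition≤⇒IsPartition (subst (λ k → Partition≤ k (φ π)) (altSumℕ≡ s γ≡j) (φ-shape s .proj₁))
  in partition , sum-φ s , bounded

φ⁻¹-correct : ∀ {j ρ} → IsPartition ρ → All (_≤ j) ρ →
  IsDistinctPartition (φ⁻¹ j ρ) × evenSum (φ⁻¹ j ρ) ≡ sum ρ × altSum (φ⁻¹ j ρ) ≡ + j
φ⁻¹-correct partition bounded =
  let parts = IsPartition⇒Partition≤ partition bounded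
      s , γ≡j , φψ≡id = ψ-spec parts parts
  in Distinct<⇒IsDistinctPartition s , trans (sym (sum-φ s)) (cong sum φψ≡id) , trans (altSum≡altSumℕ s) (cong +_ γ≡j)

φ-φ⁻¹ : ∀ {j ρ} → IsPartition ρ → All (_≤ j) ρ → φ (φ⁻¹ j ρ) ≡ ρ
φ-φ⁻¹ partition bounded = let parts = IsPartition⇒Partition≤ partition bounded in ψ-spec parts parts .proj₂ .proj₂

φ⁻¹-φ : ∀ {j π} → IsDistinctPartition π → altSum π ≡ + j → φ⁻¹ j (φ π) ≡ π
φ⁻¹-φ {π = π} distinct γ≡j with IsDistinctPartition⇒Distinct< distinct
... | _ , s = subst (λ k → ψ k k (φ π) ≡ π) (altSumℕ≡ s γ≡j) (ψ-φ s (φ-shape s .proj₁))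

×-irrelevant : ∀ {A B : Set} → Irrelevant A → Irrelevant B → Irrelevant (A × B)
×-irrelevant irrA irrB (a , b) (a′ , b′) = cong₂ _,_ (irrA a a′) (irrB b b′)

Σ-≡-irrelevant : ∀ {B : List ℕ → Set} → (∀ {x} → Irrelevant (B x)) →
  ∀ {x y} {u : B x} {v : B y} → x ≡ y → (x , u) ≡ (y , v)
Σ-≡-irrelevant irr x≡y = Σ-≡,≡→≡ (x≡y , irr _ _)

IsDistinctPartition-irrelevant : ∀ {π} → Irrelevant (IsDistinctPartition π)
IsDistinctPartition-irrelevant = ×-irrelevant (Linked.irrelevant <-irrelevant) (All.irrelevant <-irrelevant)

IsPartition-irrelevant : ∀ {ρ} → Irrelevant (IsPartition ρ)
IsPartition-irrelevant = ×-irrelevant (Linked.irrelevant ≤-irrelevant) (All.irrelevant <-irrelevant)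

theorem1p4 : (n j : ℕ) →
    (Σ (List ℕ) (λ π → IsDistinctPartition π × evenSum π ≡ n × altSum π ≡ + j))
      ↔ (Σ (List ℕ) (λ π → IsPartition π × sum π ≡ n × All (_≤ j) π))
theorem1p4 n j = mk↔ₛ′ to from to∘from from∘to
  where
  to : Σ (List ℕ) (λ π → IsDistinctPartition π × evenSum π ≡ n × altSum π ≡ + j) →
       Σ (List ℕ) (λ π → IsPartition π × sum π ≡ n × All (_≤ j) π)
  to (π , distinct , E≡n , γ≡j) =
    let partition , sum≡E , bounded = φ-correct distinct γ≡j
    in φ π , partition , trans sum≡E E≡n , bounded

  from : Σ (List ℕ) (λ π → IsPartition π × sum π ≡ n × All (_≤ j) π) →
         Σ (List ℕ) (λ π → IsDistinctPartition π × evenSum π ≡ n × altSum π ≡ + j)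
  from (ρ , partition , sum≡n , bounded) =
    let distinct , E≡sum , γ≡j = φ⁻¹-correct partition bounded
    in φ⁻¹ j ρ , distinct , trans E≡sum sum≡n , γ≡j

  to∘from : ∀ y → to (from y) ≡ y
  to∘from (_ , partition , _ , bounded) =
    Σ-≡-irrelevant (×-irrelevant IsPartition-irrelevant (×-irrelevant ≡-irrelevant (All.irrelevant ≤-irrelevant)))
      (φ-φ⁻¹ partition bounded)

  from∘to : ∀ x → from (to x) ≡ x
  from∘to (_ , distinct , _ , γ≡j) =
    Σ-≡-irrelevant (×-irrelevant IsDistinctPartition-irrelevant (×-irrelevant ≡-irrelevant ℤ-≡-irrelevant))
      (φ⁻¹-φ distinct γ≡j)
    where
    ℤ-≡-irrelevant : ∀ {x y : ℤ.ℤ} → Irrelevant (x ≡ y)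
    ℤ-≡-irrelevant = Decidable⇒UIP.≡-irrelevant ℤP._≟_
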